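{- (i) For all positive integers $k,l$, $sat^*([k]\times[l],\{\vee_2,\wedge_2\})=\max\{k,l\}$. (ii) For all positive integers $k,l$, $sat^*([k]\times[l],\vee_2)=La^*([k]\times[l],\vee_2)=k+l-1$.
   Context: $[k]\times[l]$ carries the coordinatewise order. $\vee_2$ is the poset on elements $a,b_1,b_2$ whose only relations are $a<b_1$, $a<b_2$; $\wedge_2$ is the poset on $a,b_1,b_2$ whose only relations are $b_1<a$, $b_2<a$. A poset $P$ is a strong subposet of $R$ if there is an injection $i:P\to R$ with $p\le_P p'\iff i(p)\le_R i(p')$. A subset $F$ of a poset $Q$ is strong $P$-free if $P$ is not a strong subposet of $F$; for a family, strong $\{P_1,P_2\}$-free means strong $P_1$-free and strong $P_2$-free. $F$ is strong saturated (for $P$ or for the family) if it is strong free but $F\cup\{x\}$ is not strong free for every $x\in Q\setminus F$. $La^*(Q,\cdot)$ is the maximum size of a strong free subset and $sat^*(Q,\cdot)$ is the minimum size of a strong saturated subset of $Q$. -}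

module Defs where

open import Level using (0ℓ)
open import Data.Nat using (ℕ; zero; suc; _+_; _∸_; _⊔_; _≤_)
open import Data.Fin using (Fin; zero; suc)
import Data.Fin as Fin
open import Data.Fin.Subset using (Subset; _∈_; ∣_∣)
open import Data.Product using (Σ; _×_; _,_; proj₁; proj₂)
open import Data.Sum using (_⊎_)
open import Data.List using (List)
open import Data.List.Relation.Unary.All using (All)
open import Relation.Nullary using (¬_)
open import Relation.Binary.PropositionalEquality using (_≡_)
open import Function.Definitions using (Injective)

-- A finite poset, given by its carrier size and its order relation
-- (only the relation is used by the strong-subposet notion).
record FinPoset : Set₁ where
  field
    size : ℕ
    _≼_  : Fin size → Fin size → Set

data V≤ : Fin 3 → Fin 3 → Set where
  V-refl : ∀ {p} → V≤ p p
  V-a<b  : ∀ {q} → V≤ zero (suc q)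

data Λ≤ : Fin 3 → Fin 3 → Set where
  Λ-refl : ∀ {p} → Λ≤ p p
  Λ-b<a  : ∀ {q} → Λ≤ (suc q) zero

∨₂ : FinPoset
∨₂ = record { size = 3 ; _≼_ = V≤ }

∧₂ : FinPoset
∧₂ = record { size = 3 ; _≼_ = Λ≤ }

Grid : ℕ → ℕ → Set
Grid k l = Fin k × Fin l

_≤G_ : ∀ {k l} → Grid k l → Grid k l → Set
(i , j) ≤G (i′ , j′) = (i Fin.≤ i′) × (j Fin.≤ j′)

GSub : ℕ → ℕ → Set
GSub k l = Fin k → Subset l

_∈G_ : ∀ {k l} → Grid k l → GSub k l → Set
(i , j) ∈G F = j ∈ F i

∣_∣G : ∀ {k l} → GSub k l → ℕ
∣_∣G {zero}  F = 0
∣_∣G {suc k} F = ∣ F zero ∣ + ∣ (λ i → F (suc i)) ∣G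

StrongSub : ∀ {k l} → FinPoset → (Grid k l → Set) → Set
StrongSub {k} {l} P S =
  Σ (Fin (FinPoset.size P) → Grid k l) λ ι →
    Injective _≡_ _≡_ ι ×
    (∀ p → S (ι p)) ×
    (∀ p q → (FinPoset._≼_ P p q → ι p ≤G ι q) × (ι p ≤G ι q → FinPoset._≼_ P p q))

-- strong free for the family Ps (a single poset P is the family [P])
StrongFree : ∀ {k l} → List FinPoset → (Grid k l → Set) → Set₁
StrongFree Ps S = All (λ P → ¬ StrongSub P S) Ps

StrongSaturated : ∀ {k l} → List FinPoset → GSub k l → Set₁
StrongSaturated {k} {l} Ps F =
  StrongFree Ps (λ y → y ∈G F) ×
  (∀ (x : Grid k l) → ¬ (x ∈G F) → ¬ StrongFree Ps (λ y → y ∈G F ⊎ y ≡ x))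

SatStarIs : ℕ → ℕ → List FinPoset → ℕ → Set₁
SatStarIs k l Ps m =
  (Σ (GSub k l) λ F → StrongSaturated Ps F × ∣ F ∣G ≡ m) ×
  (∀ (F : GSub k l) → StrongSaturated Ps F → m ≤ ∣ F ∣G)

LaStarIs : ℕ → ℕ → List FinPoset → ℕ → Set₁
LaStarIs k l Ps m =
  (Σ (GSub k l) λ F → StrongFree Ps (λ y → y ∈G F) × ∣ F ∣G ≡ m) ×
  (∀ (F : GSub k l) → StrongFree Ps (λ y → y ∈G F) → ∣ F ∣G ≤ m)

-- A strong ∨₂ (∧₂) in a set S of grid points is a point of S below (above) two
-- incomparable points of S.
--
-- A saturated S meets every row: if row i were empty, let m be the first point of the
-- nearest occupied row above it (or the last point of the nearest occupied row below it);
-- then x = (i , col m) relates to the points of S as m does, so m can replace x in any new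
-- copy and x could be added.  By symmetry S meets every column, so |S| ≥ max(k,l).  For ∨₂
-- alone a point that is last in its row and top in its column must lie in the last
-- column, since otherwise a point can be added to its right; so the k row maxima and the
-- tops of the first l - 1 columns are k + l - 1 distinct points.  In a ∨₂-free set a point
-- with a right neighbour is the top of its column, so labelling such points by their
-- column and the others by their row is injective into k + l - 1 values.
--
-- The first row plus the last column is a ∨₂-saturated chain of size k + l - 1.  The
-- antidiagonal row + col = min(k,l) - 1, prolonged along the first row and column, is
-- {∨₂,∧₂}-saturated of size max(k,l): a point below it is the root of a V, one above it
-- the top of a Λ.

module Submission where

open import Defs
open import Data.Nat
  using (ℕ; zero; suc; _+_; _∸_; _⊔_; _⊓_; _≤_; _<_; z≤n; s≤s; s≤s⁻¹; ≢-nonZero)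
import Data.Nat.Properties as ℕ
open import Data.Nat.Properties using (module ≤-Reasoning)
open import Data.Fin using (Fin; zero; suc; fromℕ; fromℕ<; toℕ; inject₁)
  renaming (_≤_ to _≤ᶠ_; _<_ to _<ᶠ_)
import Data.Fin.Properties as Fin
open import Data.Fin.Subset using (Subset; _∈_; ∣_∣; inside; outside)
open import Data.Fin.Subset.Properties using (_∈?_)
open import Data.Vec using ([]; _∷_; here; there; tabulate)
open import Data.Vec.Properties using (lookup∘tabulate; lookup⇒[]=; []=⇒lookup)
open import Data.Product using (∃; _×_; _,_; proj₁; proj₂; swap; map₁)
open import Data.Sum using (_⊎_; inj₁; inj₂)
import Data.Sum as Sum
open import Data.List using (List; []; _∷_; map; _++_; length; upTo; allFin)
open import Data.List.Properties using (length-++; length-map; length-upTo; length-tabulate)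
open import Data.List.Relation.Unary.All as All using ([]; _∷_)
import Data.List.Relation.Unary.All.Properties as All
open import Data.List.Relation.Unary.Any using (here; there)
open import Data.List.Relation.Unary.AllPairs using ([]; _∷_)
open import Data.List.Relation.Unary.Unique.Propositional using (Unique)
import Data.List.Relation.Unary.Unique.Propositional.Properties as Unique
open import Data.List.Relation.Binary.Subset.Propositional using (_⊆_)
open import Data.List.Membership.Propositional using () renaming (_∈_ to _∈ₗ_)
open import Data.List.Membership.Propositional.Properties
  using (∈-∃++; ∈-++⁻; ∈-++⁺ˡ; ∈-++⁺ʳ; ∈-map⁺; ∈-map⁻; ∈-upTo⁺)
open import Data.Empty using (⊥; ⊥-elim)
open import Function using (_∘_; flip; id)
open import Function.Definitions using (Injective)
open import Relation.Nullary using (¬_; Dec; yes; no; does)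
open import Relation.Nullary.Decidable using (_×-dec_; _⊎-dec_; dec-true)
open import Relation.Unary using (Decidable)
open import Relation.Binary using (Reflexive; Transitive; tri<; tri≈; tri>)
open import Relation.Binary.PropositionalEquality
  using (_≡_; _≢_; refl; sym; trans; cong; cong₂; subst; module ≡-Reasoning)

-- Finite search and counting

least : ∀ {n} {P : Fin n → Set} → Decidable P → ∃ P →
  ∃ λ i → P i × (∀ {j} → P j → i ≤ᶠ j)
least {suc n} {P} P? (i , Pi) with P? zero
... | yes P0 = zero , P0 , λ _ → z≤n
... | no ¬P0 with i | Pi
...   | zero  | P0 = ⊥-elim (¬P0 P0)
...   | suc i′ | Pi′ with i⁻ , Pi⁻ , minimal ← least (P? ∘ suc) (i′ , Pi′) =
  suc i⁻ , Pi⁻ , minimal′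
  where
  minimal′ : ∀ {j} → P j → suc i⁻ ≤ᶠ j
  minimal′ {zero}  P0 = ⊥-elim (¬P0 P0)
  minimal′ {suc j} Pj = s≤s (minimal Pj)

greatest : ∀ {n} {P : Fin n → Set} → Decidable P → ∃ P →
  ∃ λ i → P i × (∀ {j} → P j → j ≤ᶠ i)
greatest {suc n} {P} P? (i , Pi) with Fin.any? (P? ∘ suc)
... | yes P+ with i⁺ , Pi⁺ , maximal ← greatest (P? ∘ suc) P+ = suc i⁺ , Pi⁺ , maximal′
  where
  maximal′ : ∀ {j} → P j → j ≤ᶠ suc i⁺
  maximal′ {zero}  _  = z≤n
  maximal′ {suc j} Pj = s≤s (maximal Pj)
... | no ¬P+ = zero , onlyZero i Pi , maximal
  where
  onlyZero : ∀ i → P i → P zero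
  onlyZero zero    P0 = P0
  onlyZero (suc i) Pi = ⊥-elim (¬P+ (i , Pi))
  maximal : ∀ {j} → P j → j ≤ᶠ zero {n}
  maximal {zero}  _  = z≤n
  maximal {suc j} Pj = ⊥-elim (¬P+ (j , Pj))

unique-⊆⇒length≤ : ∀ {A : Set} {xs ys : List A} → Unique xs → xs ⊆ ys → length xs ≤ length ys
unique-⊆⇒length≤ {xs = []} _ _ = z≤n
unique-⊆⇒length≤ {xs = x ∷ xs} (x∉xs ∷ xs!) x∷xs⊆ys
  with ys₁ , ys₂ , refl ← ∈-∃++ (x∷xs⊆ys (here refl)) =
  ℕ.≤-trans (s≤s (unique-⊆⇒length≤ xs! xs⊆ys₁ys₂)) (ℕ.≤-reflexive length-middle)
  where
  xs⊆ys₁ys₂ : xs ⊆ ys₁ ++ ys₂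
  xs⊆ys₁ys₂ y∈xs with ∈-++⁻ ys₁ (x∷xs⊆ys (there y∈xs))
  ... | inj₁ y∈ys₁ = ∈-++⁺ˡ y∈ys₁
  ... | inj₂ (here y≡x) = ⊥-elim (All.lookup x∉xs y∈xs (sym y≡x))
  ... | inj₂ (there y∈ys₂) = ∈-++⁺ʳ ys₁ y∈ys₂
  length-middle : suc (length (ys₁ ++ ys₂)) ≡ length (ys₁ ++ x ∷ ys₂)
  length-middle = trans (cong suc (length-++ ys₁))
    (trans (sym (ℕ.+-suc (length ys₁) (length ys₂))) (sym (length-++ ys₁)))

unique-map⁺ : ∀ {A B : Set} {f : A → B} {xs : List A} → Unique xs →
  (∀ {y z} → y ∈ₗ xs → z ∈ₗ xs → f y ≡ f z → y ≡ z) → Unique (map f xs)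
unique-map⁺ {xs = []} _ _ = []
unique-map⁺ {xs = x ∷ xs} (x∉xs ∷ xs!) f-inj =
  All.map⁺ (All.tabulate λ y∈xs fx≡fy → All.lookup x∉xs y∈xs (f-inj (here refl) (there y∈xs) fx≡fy))
  ∷ unique-map⁺ xs! λ y∈ z∈ → f-inj (there y∈) (there z∈)

subsetElements : ∀ {n} → Subset n → List (Fin n)
subsetElements []            = []
subsetElements (inside ∷ p)  = zero ∷ map suc (subsetElements p)
subsetElements (outside ∷ p) = map suc (subsetElements p)

length-subsetElements : ∀ {n} (p : Subset n) → length (subsetElements p) ≡ ∣ p ∣
length-subsetElements []            = refl
length-subsetElements (inside ∷ p)  =
  cong suc (trans (length-map Fin.suc (subsetElements p)) (length-subsetElements p))
length-subsetElements (outside ∷ p) =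
  trans (length-map Fin.suc (subsetElements p)) (length-subsetElements p)

∈-subsetElements⁺ : ∀ {n} (p : Subset n) {j} → j ∈ p → j ∈ₗ subsetElements p
∈-subsetElements⁺ (inside ∷ p)  here       = here refl
∈-subsetElements⁺ (inside ∷ p)  (there j∈) = there (∈-map⁺ suc (∈-subsetElements⁺ p j∈))
∈-subsetElements⁺ (outside ∷ p) (there j∈) = ∈-map⁺ suc (∈-subsetElements⁺ p j∈)

∈-subsetElements⁻ : ∀ {n} (p : Subset n) {j} → j ∈ₗ subsetElements p → j ∈ p
∈-subsetElements⁻ (inside ∷ p) (here refl) = here
∈-subsetElements⁻ (inside ∷ p) (there j∈) with _ , j∈′ , refl ← ∈-map⁻ suc j∈ =
  there (∈-subsetElements⁻ p j∈′)
∈-subsetElements⁻ (outside ∷ p) j∈ with _ , j∈′ , refl ← ∈-map⁻ suc j∈ =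
  there (∈-subsetElements⁻ p j∈′)

subsetElements-unique : ∀ {n} (p : Subset n) → Unique (subsetElements p)
subsetElements-unique []            = []
subsetElements-unique (inside ∷ p)  =
  All.tabulate (λ j∈ 0≡j → zero∉ (subst (_∈ₗ _) (sym 0≡j) j∈))
  ∷ Unique.map⁺ Fin.suc-injective (subsetElements-unique p)
  where
  zero∉ : ¬ zero ∈ₗ map suc (subsetElements p)
  zero∉ 0∈ with _ , _ , () ← ∈-map⁻ suc 0∈
subsetElements-unique (outside ∷ p) = Unique.map⁺ Fin.suc-injective (subsetElements-unique p)

elements : ∀ {k l} → GSub k l → List (Grid k l)
elements {zero}  F = []
elements {suc k} F = map (zero ,_) (subsetElements (F zero)) ++ map (map₁ suc) (elements (F ∘ suc))

length-elements : ∀ {k l} (F : GSub k l) → length (elements F) ≡ ∣ F ∣G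
length-elements {zero}  F = refl
length-elements {suc k} F = begin
  length (map (zero ,_) (subsetElements (F zero)) ++ map (map₁ suc) (elements (F ∘ suc)))
    ≡⟨ length-++ (map (zero ,_) (subsetElements (F zero))) ⟩
  length (map (zero ,_) (subsetElements (F zero))) + length (map (map₁ suc) (elements (F ∘ suc)))
    ≡⟨ cong₂ _+_ (length-map _ (subsetElements (F zero))) (length-map _ (elements (F ∘ suc))) ⟩
  length (subsetElements (F zero)) + length (elements (F ∘ suc))
    ≡⟨ cong₂ _+_ (length-subsetElements (F zero)) (length-elements (F ∘ suc)) ⟩
  ∣ F ∣G ∎
  where open ≡-Reasoning

∈-elements⁺ : ∀ {k l} (F : GSub k l) {y} → y ∈G F → y ∈ₗ elements F
∈-elements⁺ {suc k} F {zero  , j} j∈ = ∈-++⁺ˡ (∈-map⁺ _ (∈-subsetElements⁺ (F zero) j∈))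
∈-elements⁺ {suc k} F {suc i , j} j∈ =
  ∈-++⁺ʳ (map (zero ,_) (subsetElements (F zero))) (∈-map⁺ _ (∈-elements⁺ (F ∘ suc) {i , j} j∈))

∈-elements⁻ : ∀ {k l} (F : GSub k l) {y} → y ∈ₗ elements F → y ∈G F
∈-elements⁻ {suc k} F y∈ with ∈-++⁻ (map (zero ,_) (subsetElements (F zero))) y∈
... | inj₁ y∈₀ with _ , j∈ , refl ← ∈-map⁻ _ y∈₀ = ∈-subsetElements⁻ (F zero) j∈
... | inj₂ y∈₊ with _ , y∈′ , refl ← ∈-map⁻ _ y∈₊ = ∈-elements⁻ (F ∘ suc) y∈′

elements-unique : ∀ {k l} (F : GSub k l) → Unique (elements F)
elements-unique {zero}  F = []
elements-unique {suc k} {l} F =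
  Unique.++⁺ (Unique.map⁺ (cong proj₂) (subsetElements-unique (F zero)))
             (Unique.map⁺ map₁-suc-injective (elements-unique (F ∘ suc)))
             λ (y∈₀ , y∈₊) → disjoint y∈₀ y∈₊
  where
  map₁-suc-injective : ∀ {y z : Grid k l} → map₁ suc y ≡ map₁ suc z → y ≡ z
  map₁-suc-injective {_ , _} {_ , _} refl = refl
  disjoint : ∀ {y} → y ∈ₗ map (zero ,_) (subsetElements (F zero)) →
             y ∈ₗ map (map₁ suc) (elements (F ∘ suc)) → ⊥
  disjoint y∈₀ y∈₊ with _ , _ , refl ← ∈-map⁻ _ y∈₀ | _ , _ , () ← ∈-map⁻ _ y∈₊

module _ {k l} (F : GSub k l) where

  unique⇒length≤∣∣G : ∀ {ys : List (Grid k l)} → Unique ys → (∀ {y} → y ∈ₗ ys → y ∈G F) →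
    length ys ≤ ∣ F ∣G
  unique⇒length≤∣∣G ys! ys⊆F =
    subst (_ ≤_) (length-elements F) (unique-⊆⇒length≤ ys! (∈-elements⁺ F ∘ ys⊆F))

  injectiveOn⇒∣∣G≤ : ∀ (f : Grid k l → ℕ) {n} →
    (∀ {y z} → y ∈G F → z ∈G F → f y ≡ f z → y ≡ z) → (∀ {y} → y ∈G F → f y < n) → ∣ F ∣G ≤ n
  injectiveOn⇒∣∣G≤ f {n} f-inj f<n = begin
    ∣ F ∣G                       ≡⟨ sym (length-elements F) ⟩
    length (elements F)          ≡⟨ sym (length-map f (elements F)) ⟩
    length (map f (elements F))  ≤⟨ unique-⊆⇒length≤ fF! fF⊆upTo ⟩
    length (upTo n)              ≡⟨ length-upTo n ⟩
    n                            ∎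
    where
    open ≤-Reasoning
    fF! : Unique (map f (elements F))
    fF! = unique-map⁺ (elements-unique F) λ y∈ z∈ → f-inj (∈-elements⁻ F y∈) (∈-elements⁻ F z∈)
    fF⊆upTo : map f (elements F) ⊆ upTo n
    fF⊆upTo fy∈ with _ , y∈ , refl ← ∈-map⁻ f fy∈ = ∈-upTo⁺ (f<n (∈-elements⁻ F y∈))

  private
    length-map-allFin : ∀ {n} (f : Fin n → Grid k l) → length (map f (allFin n)) ≡ n
    length-map-allFin {n} f = trans (length-map f (allFin n)) (length-tabulate id)

    map-allFin⊆F : ∀ {n} (f : Fin n → Grid k l) → (∀ p → f p ∈G F) →
      ∀ {y} → y ∈ₗ map f (allFin n) → y ∈G F
    map-allFin⊆F f f∈ y∈ with p , _ , refl ← ∈-map⁻ f y∈ = f∈ p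

  injection⇒≤∣∣G : ∀ {n} (f : Fin n → Grid k l) → Injective _≡_ _≡_ f → (∀ p → f p ∈G F) →
    n ≤ ∣ F ∣G
  injection⇒≤∣∣G {n} f f-inj f∈ = subst (_≤ ∣ F ∣G) (length-map-allFin f)
    (unique⇒length≤∣∣G (Unique.map⁺ f-inj (Unique.allFin⁺ n)) (map-allFin⊆F f f∈))

  disjointInjections⇒+≤∣∣G : ∀ {m n} (f : Fin m → Grid k l) (g : Fin n → Grid k l) →
    Injective _≡_ _≡_ f → Injective _≡_ _≡_ g → (∀ p q → f p ≢ g q) →
    (∀ p → f p ∈G F) → (∀ q → g q ∈G F) → m + n ≤ ∣ F ∣G
  disjointInjections⇒+≤∣∣G {m} {n} f g f-inj g-inj f≢g f∈ g∈ = subst (_≤ ∣ F ∣G) length-fg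
    (unique⇒length≤∣∣G
      (Unique.++⁺ (Unique.map⁺ f-inj (Unique.allFin⁺ m)) (Unique.map⁺ g-inj (Unique.allFin⁺ n)) disjoint)
      λ y∈ → Sum.[ map-allFin⊆F f f∈ , map-allFin⊆F g g∈ ] (∈-++⁻ (map f (allFin m)) y∈))
    where
    length-fg : length (map f (allFin m) ++ map g (allFin n)) ≡ m + n
    length-fg = trans (length-++ (map f (allFin m))) (cong₂ _+_ (length-map-allFin f) (length-map-allFin g))
    disjoint : ∀ {y} → y ∈ₗ map f (allFin m) × y ∈ₗ map g (allFin n) → ⊥
    disjoint (fp∈ , gq∈) with p , _ , refl ← ∈-map⁻ f fp∈ | q , _ , fp≡gq ← ∈-map⁻ g gq∈ =
      f≢g p q fp≡gq

fromDec : ∀ {k l} {P : Grid k l → Set} → Decidable P → GSub k l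
fromDec P? i = tabulate λ j → does (P? (i , j))

module _ {k l} {P : Grid k l → Set} (P? : Decidable P) where

  ∈-fromDec⁺ : ∀ {y} → P y → y ∈G fromDec P?
  ∈-fromDec⁺ {i , j} Py = lookup⇒[]= j _ (trans (lookup∘tabulate _ j) (dec-true (P? (i , j)) Py))

  ∈-fromDec⁻ : ∀ {y} → y ∈G fromDec P? → P y
  ∈-fromDec⁻ {i , j} y∈
    with P? (i , j) | trans (sym (lookup∘tabulate (λ j → does (P? (i , j))) j)) ([]=⇒lookup y∈)
  ... | yes Py | _ = Py
  ... | no _   | ()

_∈G?_ : ∀ {k l} (y : Grid k l) (F : GSub k l) → Dec (y ∈G F)
(i , j) ∈G? F = j ∈? F i

-- Forks in a relation

_∪₁_ : ∀ {A : Set} → (A → Set) → A → A → Set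
(S ∪₁ x) y = S y ⊎ y ≡ x

module _ {A : Set} (_≼_ : A → A → Set) where

  record Fork (S : A → Set) : Set where
    constructor fork
    field
      root left right : A
      root∈ : S root
      left∈ : S left
      right∈ : S right
      root≼left : root ≼ left
      root≼right : root ≼ right
      left⋠right : ¬ left ≼ right
      right⋠left : ¬ right ≼ left

  record Mimics (S : A → Set) (x m : A) : Set where
    field
      below : ∀ {y} → S y → y ≼ x → y ≼ m
      above : ∀ {y} → S y → x ≼ y → m ≼ y
      comparable-above : ∀ {y} → S y → m ≼ y → x ≼ y ⊎ y ≼ x
      comparable-below : ∀ {y} → S y → y ≼ m → x ≼ y ⊎ y ≼ x

module _ {A : Set} {_≼_ : A → A → Set} where

  fork-swap : ∀ {S} → Fork _≼_ S → Fork _≼_ S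
  fork-swap (fork a b d a∈ b∈ d∈ a≼b a≼d b⋠d d⋠b) = fork a d b a∈ d∈ b∈ a≼d a≼b d⋠b b⋠d

  mimics-flip : ∀ {S x m} → Mimics _≼_ S x m → Mimics (flip _≼_) S x m
  mimics-flip M = record
    { below = above
    ; above = below
    ; comparable-above = λ y∈ y≼m → Sum.swap (comparable-below y∈ y≼m)
    ; comparable-below = λ y∈ m≼y → Sum.swap (comparable-above y∈ m≼y)
    }
    where open Mimics M

  fork-∪₁-elim : Reflexive _≼_ → ∀ {S x} →
    (∀ {b d} → S b → S d → x ≼ b → x ≼ d → ¬ b ≼ d → ¬ d ≼ b → Fork _≼_ S) →
    (∀ {a d} → S a → S d → a ≼ x → a ≼ d → ¬ x ≼ d → ¬ d ≼ x → Fork _≼_ S) →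
    Fork _≼_ (S ∪₁ x) → Fork _≼_ S
  fork-∪₁-elim _ _ _ (fork a b d (inj₁ a∈) (inj₁ b∈) (inj₁ d∈) a≼b a≼d b⋠d d⋠b) =
    fork a b d a∈ b∈ d∈ a≼b a≼d b⋠d d⋠b
  fork-∪₁-elim _ rootCase _ (fork _ _ _ (inj₂ refl) (inj₁ b∈) (inj₁ d∈) x≼b x≼d b⋠d d⋠b) =
    rootCase b∈ d∈ x≼b x≼d b⋠d d⋠b
  fork-∪₁-elim _ _ tineCase (fork _ _ _ (inj₁ a∈) (inj₂ refl) (inj₁ d∈) a≼x a≼d x⋠d d⋠x) =
    tineCase a∈ d∈ a≼x a≼d x⋠d d⋠x
  fork-∪₁-elim _ _ tineCase (fork _ _ _ (inj₁ a∈) (inj₁ b∈) (inj₂ refl) a≼b a≼x b⋠x x⋠b) =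
    fork-swap (tineCase a∈ b∈ a≼x a≼b x⋠b b⋠x)
  fork-∪₁-elim _ _ _ (fork _ _ _ (inj₂ refl) (inj₂ refl) _ _ x≼d x⋠d _) = ⊥-elim (x⋠d x≼d)
  fork-∪₁-elim _ _ _ (fork _ _ _ (inj₂ refl) (inj₁ _) (inj₂ refl) x≼b _ _ b⋠x) = ⊥-elim (b⋠x x≼b)
  fork-∪₁-elim ≼-refl _ _ (fork _ _ _ (inj₁ _) (inj₂ refl) (inj₂ refl) _ _ x⋠x _) =
    ⊥-elim (x⋠x ≼-refl)

  mimic-fork : Reflexive _≼_ → ∀ {S x m} → S m → Mimics _≼_ S x m →
    Fork _≼_ (S ∪₁ x) → Fork _≼_ S
  mimic-fork ≼-refl {m = m} m∈ M = fork-∪₁-elim ≼-refl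
    (λ b∈ d∈ x≼b x≼d → fork m _ _ m∈ b∈ d∈ (above b∈ x≼b) (above d∈ x≼d))
    (λ a∈ d∈ a≼x a≼d x⋠d d⋠x → let x∦d = Sum.[ x⋠d , d⋠x ] in
      fork _ m _ a∈ m∈ d∈ (below a∈ a≼x) a≼d
        (x∦d ∘ comparable-above d∈) (x∦d ∘ comparable-below d∈))
    where open Mimics M

fork-map : ∀ {A B : Set} {_≼_ : A → A → Set} {_⊑_ : B → B → Set} {S : A → Set} {T : B → Set}
  (g : A → B) → (∀ {y z} → y ≼ z → g y ⊑ g z) → (∀ {y z} → g y ⊑ g z → y ≼ z) →
  (∀ {y} → S y → T (g y)) → Fork _≼_ S → Fork _⊑_ T
fork-map g mono comono g∈ (fork a b d a∈ b∈ d∈ a≼b a≼d b⋠d d⋠b) =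
  fork (g a) (g b) (g d) (g∈ a∈) (g∈ b∈) (g∈ d∈) (mono a≼b) (mono a≼d)
    (b⋠d ∘ comono) (d⋠b ∘ comono)

chain⇒noFork : ∀ {A : Set} {_≼_ : A → A → Set} {S : A → Set} →
  (∀ {y z} → S y → S z → y ≼ z ⊎ z ≼ y) → ¬ Fork _≼_ S
chain⇒noFork comparable (fork _ b d _ b∈ d∈ _ _ b⋠d d⋠b) =
  Sum.[ b⋠d , d⋠b ] (comparable {b} {d} b∈ d∈)

module _ {A : Set} {_≼_ : A → A → Set} {S : A → Set} (F : Fork _≼_ S) where
  open Fork F

  forkPoints : Fin 3 → A
  forkPoints zero             = root
  forkPoints (suc zero)       = left
  forkPoints (suc (suc zero)) = right

  forkPoints-∈ : ∀ p → S (forkPoints p)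
  forkPoints-∈ zero             = root∈
  forkPoints-∈ (suc zero)       = left∈
  forkPoints-∈ (suc (suc zero)) = right∈

  forkPoints-mono : Reflexive _≼_ → ∀ {p q} → V≤ p q → forkPoints p ≼ forkPoints q
  forkPoints-mono ≼-refl V-refl = ≼-refl
  forkPoints-mono _ {q = suc zero}       V-a<b = root≼left
  forkPoints-mono _ {q = suc (suc zero)} V-a<b = root≼right

  forkPoints-comono : Transitive _≼_ → ∀ p q → forkPoints p ≼ forkPoints q → V≤ p q
  forkPoints-comono _ zero zero _ = V-refl
  forkPoints-comono _ zero (suc _) _ = V-a<b
  forkPoints-comono _ (suc zero) (suc zero) _ = V-refl
  forkPoints-comono _ (suc (suc zero)) (suc (suc zero)) _ = V-refl
  forkPoints-comono _ (suc zero) (suc (suc zero)) b≼d = ⊥-elim (left⋠right b≼d)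
  forkPoints-comono _ (suc (suc zero)) (suc zero) d≼b = ⊥-elim (right⋠left d≼b)
  forkPoints-comono ≼-trans (suc zero) zero b≼a =
    ⊥-elim (left⋠right (≼-trans b≼a root≼right))
  forkPoints-comono ≼-trans (suc (suc zero)) zero d≼a =
    ⊥-elim (right⋠left (≼-trans d≼a root≼left))

  forkPoints-injective : Reflexive _≼_ → Transitive _≼_ → Injective _≡_ _≡_ forkPoints
  forkPoints-injective ≼-refl ≼-trans {p} {q} ιp≡ιq = V≤-antisym
    (forkPoints-comono ≼-trans p q (subst (forkPoints p ≼_) ιp≡ιq ≼-refl))
    (forkPoints-comono ≼-trans q p (subst (_≼ forkPoints p) ιp≡ιq ≼-refl))
    where
    V≤-antisym : ∀ {p q} → V≤ p q → V≤ q p → p ≡ q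
    V≤-antisym V-refl _ = refl

-- Strong copies of ∨₂ and ∧₂ in the grid

module _ {k l : ℕ} where

  ≤G-refl : Reflexive (_≤G_ {k} {l})
  ≤G-refl = Fin.≤-refl , Fin.≤-refl

  ≤G-trans : Transitive (_≤G_ {k} {l})
  ≤G-trans (p , q) (p′ , q′) = Fin.≤-trans p p′ , Fin.≤-trans q q′

  VShape ΛShape : (Grid k l → Set) → Set
  VShape = Fork _≤G_
  ΛShape = Fork (flip _≤G_)

  VShape⇒StrongSub : ∀ {S} → VShape S → StrongSub ∨₂ S
  VShape⇒StrongSub F =
    forkPoints F , forkPoints-injective F ≤G-refl ≤G-trans , forkPoints-∈ F ,
    λ p q → forkPoints-mono F ≤G-refl , forkPoints-comono F ≤G-trans p q

  ΛShape⇒StrongSub : ∀ {S} → ΛShape S → StrongSub ∧₂ S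
  ΛShape⇒StrongSub F =
    forkPoints F , forkPoints-injective F ≤G-refl (flip ≤G-trans) , forkPoints-∈ F ,
    λ p q → forkPoints-mono F ≤G-refl ∘ Λ≤⇒V≤ , V≤⇒Λ≤ ∘ forkPoints-comono F (flip ≤G-trans) q p
    where
    Λ≤⇒V≤ : ∀ {p q} → Λ≤ p q → V≤ q p
    Λ≤⇒V≤ Λ-refl = V-refl
    Λ≤⇒V≤ Λ-b<a = V-a<b
    V≤⇒Λ≤ : ∀ {p q} → V≤ q p → Λ≤ p q
    V≤⇒Λ≤ V-refl = Λ-refl
    V≤⇒Λ≤ V-a<b = Λ-b<a

  StrongSub⇒VShape : ∀ {S} → StrongSub ∨₂ S → VShape S
  StrongSub⇒VShape (ι , _ , ι∈ , ord) =
    fork _ _ _ (ι∈ zero) (ι∈ (suc zero)) (ι∈ (suc (suc zero)))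
      (proj₁ (ord _ _) V-a<b) (proj₁ (ord _ _) V-a<b) (b≰d ∘ proj₂ (ord _ _)) (d≰b ∘ proj₂ (ord _ _))
    where
    b≰d : ¬ V≤ (suc zero) (suc (suc zero))
    b≰d ()
    d≰b : ¬ V≤ (suc (suc zero)) (suc zero)
    d≰b ()

  StrongSub⇒ΛShape : ∀ {S} → StrongSub ∧₂ S → ΛShape S
  StrongSub⇒ΛShape (ι , _ , ι∈ , ord) =
    fork _ _ _ (ι∈ zero) (ι∈ (suc zero)) (ι∈ (suc (suc zero)))
      (proj₁ (ord _ _) Λ-b<a) (proj₁ (ord _ _) Λ-b<a) (d≰b ∘ proj₂ (ord _ _)) (b≰d ∘ proj₂ (ord _ _))
    where
    b≰d : ¬ Λ≤ (suc zero) (suc (suc zero))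
    b≰d ()
    d≰b : ¬ Λ≤ (suc (suc zero)) (suc zero)
    d≰b ()

  strongFree-∨₂⁺ : ∀ {S} → ¬ VShape S → StrongFree (∨₂ ∷ []) S
  strongFree-∨₂⁺ noV = noV ∘ StrongSub⇒VShape ∷ []

  strongFree-∨₂⁻ : ∀ {S} → StrongFree (∨₂ ∷ []) S → ¬ VShape S
  strongFree-∨₂⁻ (no∨₂ ∷ []) = no∨₂ ∘ VShape⇒StrongSub

  strongFree-∨₂∧₂⁺ : ∀ {S} → ¬ VShape S → ¬ ΛShape S → StrongFree (∨₂ ∷ ∧₂ ∷ []) S
  strongFree-∨₂∧₂⁺ noV noΛ = noV ∘ StrongSub⇒VShape ∷ noΛ ∘ StrongSub⇒ΛShape ∷ []

  strongFree-∨₂∧₂⁻ : ∀ {S} → StrongFree (∨₂ ∷ ∧₂ ∷ []) S → ¬ VShape S × ¬ ΛShape S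
  strongFree-∨₂∧₂⁻ (no∨₂ ∷ no∧₂ ∷ []) =
    no∨₂ ∘ VShape⇒StrongSub , no∧₂ ∘ ΛShape⇒StrongSub

-- Saturated sets meet every row and every column

module _ {k l : ℕ} where

  Harmless : (Grid k l → Set) → Grid k l → Set
  Harmless S x = (¬ VShape S → ¬ VShape (S ∪₁ x)) × (¬ ΛShape S → ¬ ΛShape (S ∪₁ x))

  mimic⇒harmless : ∀ {S x m} → S m → Mimics _≤G_ S x m → Harmless S x
  mimic⇒harmless m∈ M = (λ noV → noV ∘ mimic-fork ≤G-refl m∈ M)
                      , (λ noΛ → noΛ ∘ mimic-fork ≤G-refl m∈ (mimics-flip M))

  empty⇒harmless : ∀ {S} x → (∀ y → ¬ S y) → Harmless S x
  empty⇒harmless {S} x S-empty = (λ noV → noV ∘ meetsS ≤G-refl) , (λ noΛ → noΛ ∘ meetsS ≤G-refl)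
    where
    meetsS : ∀ {_≼_} → Reflexive _≼_ → Fork _≼_ (S ∪₁ x) → Fork _≼_ S
    meetsS ≼-refl =
      fork-∪₁-elim ≼-refl (λ {b} b∈ → ⊥-elim (S-empty b b∈)) (λ {a} a∈ → ⊥-elim (S-empty a a∈))

  module _ {S : Grid k l → Set} {i : Fin k} (rowEmpty : ∀ j → ¬ S (i , j)) where

    private
      notRow : ∀ {i′ j} → S (i′ , j) → i′ ≢ i
      notRow y∈ refl = rowEmpty _ y∈

    mimicAbove : ∀ {i⁺ j⁺} → i <ᶠ i⁺ →
      (∀ {i′ j} → S (i′ , j) → i <ᶠ i′ → i⁺ ≤ᶠ i′) →
      (∀ {j} → S (i⁺ , j) → j⁺ ≤ᶠ j) → Mimics _≤G_ S (i , j⁺) (i⁺ , j⁺)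
    mimicAbove {i⁺} {j⁺} i<i⁺ nearest first = record
      { below = λ _ (i′≤i , j≤j⁺) → ℕ.≤-trans i′≤i (ℕ.<⇒≤ i<i⁺) , j≤j⁺
      ; above = λ y∈ (i≤i′ , j⁺≤j) →
          nearest y∈ (Fin.≤∧≢⇒< i≤i′ (notRow y∈ ∘ sym)) , j⁺≤j
      ; comparable-above = λ _ (i⁺≤i′ , j⁺≤j) →
          inj₁ (ℕ.<⇒≤ (ℕ.<-≤-trans i<i⁺ i⁺≤i′) , j⁺≤j)
      ; comparable-below = below
      }
      where
      below : ∀ {y} → S y → y ≤G (i⁺ , j⁺) → (i , j⁺) ≤G y ⊎ y ≤G (i , j⁺)
      below {i′ , j} y∈ (i′≤i⁺ , j≤j⁺) with Fin.<-cmp i′ i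
      ... | tri< i′<i _ _ = inj₂ (ℕ.<⇒≤ i′<i , j≤j⁺)
      ... | tri≈ _ i′≡i _ = ⊥-elim (notRow y∈ i′≡i)
      ... | tri> _ _ i<i′ with refl ← Fin.≤-antisym i′≤i⁺ (nearest y∈ i<i′) =
        inj₁ (ℕ.<⇒≤ i<i′ , first y∈)

    mimicBelow : ∀ {i⁻ j⁻} → i⁻ <ᶠ i →
      (∀ {i′ j} → S (i′ , j) → i′ <ᶠ i → i′ ≤ᶠ i⁻) →
      (∀ {j} → S (i⁻ , j) → j ≤ᶠ j⁻) → Mimics _≤G_ S (i , j⁻) (i⁻ , j⁻)
    mimicBelow {i⁻} {j⁻} i⁻<i nearest last = record
      { below = λ y∈ (i′≤i , j≤j⁻) → nearest y∈ (Fin.≤∧≢⇒< i′≤i (notRow y∈)) , j≤j⁻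
      ; above = λ _ (i≤i′ , j⁻≤j) → ℕ.≤-trans (ℕ.<⇒≤ i⁻<i) i≤i′ , j⁻≤j
      ; comparable-above = above
      ; comparable-below = λ _ (i′≤i⁻ , j≤j⁻) →
          inj₂ (ℕ.<⇒≤ (ℕ.≤-<-trans i′≤i⁻ i⁻<i) , j≤j⁻)
      }
      where
      above : ∀ {y} → S y → (i⁻ , j⁻) ≤G y → (i , j⁻) ≤G y ⊎ y ≤G (i , j⁻)
      above {i′ , j} y∈ (i⁻≤i′ , j⁻≤j) with Fin.<-cmp i′ i
      ... | tri> _ _ i<i′ = inj₁ (ℕ.<⇒≤ i<i′ , j⁻≤j)
      ... | tri≈ _ i′≡i _ = ⊥-elim (notRow y∈ i′≡i)
      ... | tri< i′<i _ _ with refl ← Fin.≤-antisym (nearest y∈ i′<i) i⁻≤i′ =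
        inj₂ (ℕ.<⇒≤ i′<i , last y∈)

  private
    occupied? : ∀ {S : Grid k l → Set} → Decidable S → Decidable (λ i → ∃ λ j → S (i , j))
    occupied? S? i = Fin.any? λ j → S? (i , j)

    OccupiedAbove OccupiedBelow : (Grid k l → Set) → Fin k → Fin k → Set
    OccupiedAbove S i i′ = i <ᶠ i′ × ∃ λ j → S (i′ , j)
    OccupiedBelow S i i′ = i′ <ᶠ i × ∃ λ j → S (i′ , j)

    occupiedAbove? : ∀ {S} → Decidable S → ∀ i → Decidable (OccupiedAbove S i)
    occupiedAbove? S? i i′ = (i Fin.<? i′) ×-dec occupied? S? i′

    occupiedBelow? : ∀ {S} → Decidable S → ∀ i → Decidable (OccupiedBelow S i)
    occupiedBelow? S? i i′ = (i′ Fin.<? i) ×-dec occupied? S? i′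

  emptyRow⇒harmless : ∀ {S} → Decidable S → ∀ {i} → (∀ j → ¬ S (i , j)) → Fin l →
    ∃ λ j → Harmless S (i , j)
  emptyRow⇒harmless {S} S? {i} rowEmpty j₀
    with Fin.any? (occupiedAbove? S? i) | Fin.any? (occupiedBelow? S? i)
  ... | yes rowAbove | _
    with i⁺ , (i<i⁺ , i⁺-occupied) , nearest ← least (occupiedAbove? S? i) rowAbove
    with j⁺ , j⁺∈ , first ← least (λ j → S? (i⁺ , j)) i⁺-occupied
    = j⁺ , mimic⇒harmless j⁺∈
        (mimicAbove rowEmpty i<i⁺ (λ y∈ i<i′ → nearest (i<i′ , _ , y∈)) first)
  ... | no _ | yes rowBelow
    with i⁻ , (i⁻<i , i⁻-occupied) , nearest ← greatest (occupiedBelow? S? i) rowBelow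
    with j⁻ , j⁻∈ , last ← greatest (λ j → S? (i⁻ , j)) i⁻-occupied
    = j⁻ , mimic⇒harmless j⁻∈
        (mimicBelow rowEmpty i⁻<i (λ y∈ i′<i → nearest (i′<i , _ , y∈)) last)
  ... | no noRowAbove | no noRowBelow = j₀ , empty⇒harmless (i , j₀) S-empty
    where
    S-empty : ∀ y → ¬ S y
    S-empty (i′ , j) y∈ with Fin.<-cmp i′ i
    ... | tri< i′<i _ _ = noRowBelow (i′ , i′<i , j , y∈)
    ... | tri≈ _ refl _ = rowEmpty j y∈
    ... | tri> _ _ i<i′ = noRowAbove (i′ , i<i′ , j , y∈)

  NoHarmless : (Grid k l → Set) → Set
  NoHarmless S = ∀ x → ¬ S x → ¬ Harmless S x

  noHarmless⇒rowNonempty : ∀ {S} → Decidable S → NoHarmless S → Fin l → ∀ i → ∃ λ j → S (i , j)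
  noHarmless⇒rowNonempty S? noHarmless j₀ i with occupied? S? i
  ... | yes nonempty = nonempty
  ... | no empty with j , harmless ← emptyRow⇒harmless S? (λ j y∈ → empty (j , y∈)) j₀ =
    ⊥-elim (noHarmless _ (λ y∈ → empty (j , y∈)) harmless)

harmless-transpose : ∀ {k l} {S : Grid k l → Set} {x} → Harmless (S ∘ swap) (swap x) → Harmless S x
harmless-transpose {S = S} {x} (hV , hΛ) =
    (λ noV → hV (noV ∘ transposeV id) ∘ transposeV ∪₁-swap)
  , (λ noΛ → hΛ (noΛ ∘ transposeΛ id) ∘ transposeΛ ∪₁-swap)
  where
  transposeV : ∀ {m n T U} → (∀ {y} → T y → U (swap y)) → VShape {m} {n} T → VShape U
  transposeV = fork-map swap swap swap
  transposeΛ : ∀ {m n T U} → (∀ {y} → T y → U (swap y)) → ΛShape {m} {n} T → ΛShape U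
  transposeΛ = fork-map swap swap swap
  ∪₁-swap : ∀ {y} → (S ∪₁ x) y → ((S ∘ swap) ∪₁ swap x) (swap y)
  ∪₁-swap (inj₁ y∈) = inj₁ y∈
  ∪₁-swap (inj₂ refl) = inj₂ refl

noHarmless⇒colNonempty : ∀ {k l} {S : Grid k l → Set} → Decidable S → NoHarmless S → Fin k →
  ∀ j → ∃ λ i → S (i , j)
noHarmless⇒colNonempty S? noHarmless =
  noHarmless⇒rowNonempty (S? ∘ swap) λ y y∉ → noHarmless (swap y) y∉ ∘ harmless-transpose

module _ {k l} {F : GSub k l} where

  saturated-∨₂⇒noHarmless : StrongSaturated (∨₂ ∷ []) F → NoHarmless (_∈G F)
  saturated-∨₂⇒noHarmless (free , saturated) x x∉ (harmlessV , _) =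
    saturated x x∉ (strongFree-∨₂⁺ (harmlessV (strongFree-∨₂⁻ free)))

  saturated-∨₂∧₂⇒noHarmless : StrongSaturated (∨₂ ∷ ∧₂ ∷ []) F → NoHarmless (_∈G F)
  saturated-∨₂∧₂⇒noHarmless (free , saturated) x x∉ (harmlessV , harmlessΛ) =
    saturated x x∉ (strongFree-∨₂∧₂⁺ (harmlessV (proj₁ noForks)) (harmlessΛ (proj₂ noForks)))
    where noForks = strongFree-∨₂∧₂⁻ free

noHarmless⇒⊔≤∣∣G : ∀ {k l} (F : GSub (suc k) (suc l)) → NoHarmless (_∈G F) →
  suc k ⊔ suc l ≤ ∣ F ∣G
noHarmless⇒⊔≤∣∣G F noHarmless = ℕ.⊔-lub
  (injection⇒≤∣∣G F (λ i → i , proj₁ (inRow i)) (cong proj₁) (proj₂ ∘ inRow))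
  (injection⇒≤∣∣G F (λ j → proj₁ (inCol j) , j) (cong proj₂) (proj₂ ∘ inCol))
  where
  inRow = noHarmless⇒rowNonempty (_∈G? F) noHarmless zero
  inCol = noHarmless⇒colNonempty (_∈G? F) noHarmless zero

-- Bounds for ∨₂

-- m is the first column right of the corner (i , j) with a point of S above row i, or the
-- last column if there is none.
module _ {k l} {S : Grid k l → Set} (noV : ¬ VShape S) {i j} (c∈ : S (i , j))
  (rowMax : ∀ {j′} → S (i , j′) → j′ ≤ᶠ j) (colMax : ∀ {i′} → S (i′ , j) → i′ ≤ᶠ i)
  {m} (j<m : j <ᶠ m)
  (nearestAbove : ∀ {i′ j′} → S (i′ , j′) → i <ᶠ i′ → j <ᶠ j′ → m ≤ᶠ j′)
  (supportAt : ∀ {i′ j′} → S (i′ , j′) → m <ᶠ j′ → ∃ λ i″ → i <ᶠ i″ × S (i″ , m))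
  where

  private
    c≤x : (i , j) ≤G (i , m)
    c≤x = Fin.≤-refl , ℕ.<⇒≤ j<m

    aboveCorner : ∀ {z} → S z → (i , j) ≤G z → z ≡ (i , j) ⊎ (i , m) ≤G z
    aboveCorner {iz , jz} z∈ (i≤iz , j≤jz) with Fin.<-cmp i iz | Fin.<-cmp j jz
    ... | tri≈ _ refl _ | _ with refl ← Fin.≤-antisym (rowMax z∈) j≤jz = inj₁ refl
    ... | tri< i<iz _ _ | tri< j<jz _ _ = inj₂ (ℕ.<⇒≤ i<iz , nearestAbove z∈ i<iz j<jz)
    ... | tri< i<iz _ _ | tri≈ _ refl _ = ⊥-elim (ℕ.<⇒≱ i<iz (colMax z∈))
    ... | tri< _ _ _    | tri> _ _ jz<j = ⊥-elim (ℕ.<⇒≱ jz<j j≤jz)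
    ... | tri> _ _ iz<i | _ = ⊥-elim (ℕ.<⇒≱ iz<i i≤iz)

    tineCase : ∀ {a z} → S a → S z → a ≤G (i , m) → a ≤G z → ¬ (i , m) ≤G z → ¬ z ≤G (i , m) →
      VShape S
    tineCase {ia , ja} {iz , jz} a∈ z∈ (ia≤i , ja≤m) a≤z x≰z z≰x with ja Fin.≤? j
    ... | yes ja≤j = fork _ _ _ a∈ c∈ z∈ (ia≤i , ja≤j) a≤z c≰z z≰c
      where
      c≰z : ¬ (i , j) ≤G (iz , jz)
      c≰z c≤z with aboveCorner z∈ c≤z
      ... | inj₁ refl = z≰x c≤x
      ... | inj₂ x≤z  = x≰z x≤z
      z≰c : ¬ (iz , jz) ≤G (i , j)
      z≰c z≤c = z≰x (≤G-trans z≤c c≤x)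
    -- Otherwise a and z lie below row i, z right of column m, and a is the root of a V
    -- with z and the point of column m above row i.
    ... | no ja≰j = supportedFork (supportAt z∈ m<jz)
      where
      j<ja : j <ᶠ ja
      j<ja = ℕ.≰⇒> ja≰j
      ia<i : ia <ᶠ i
      ia<i = Fin.≤∧≢⇒< ia≤i λ { refl → ja≰j (rowMax a∈) }
      iz<i : iz <ᶠ i
      iz<i with Fin.<-cmp iz i
      ... | tri< iz<i _ _ = iz<i
      ... | tri≈ _ refl _ = ⊥-elim (ℕ.<⇒≱ (ℕ.<-≤-trans j<ja (proj₂ a≤z)) (rowMax z∈))
      ... | tri> _ _ i<iz =
        ⊥-elim (x≰z (ℕ.<⇒≤ i<iz , nearestAbove z∈ i<iz (ℕ.<-≤-trans j<ja (proj₂ a≤z))))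
      m<jz : m <ᶠ jz
      m<jz = ℕ.≰⇒> λ jz≤m → z≰x (ℕ.<⇒≤ iz<i , jz≤m)
      supportedFork : (∃ λ i″ → i <ᶠ i″ × S (i″ , m)) → VShape S
      supportedFork (i″ , i<i″ , b∈) = fork _ _ _ a∈ z∈ b∈ a≤z
        (ℕ.<⇒≤ (ℕ.<-trans ia<i i<i″) , ja≤m)
        (λ (_ , jz≤m) → ℕ.<⇒≱ m<jz jz≤m)
        (λ (i″≤iz , _) → ℕ.<⇒≱ (ℕ.<-trans iz<i i<i″) i″≤iz)

  cornerShift-VFree : ¬ VShape (S ∪₁ (i , m))
  cornerShift-VFree = noV ∘ fork-∪₁-elim ≤G-refl
    (λ b∈ d∈ x≤b x≤d → fork _ _ _ c∈ b∈ d∈ (≤G-trans c≤x x≤b) (≤G-trans c≤x x≤d))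
    tineCase

module _ {k l} {S : Grid k (suc l) → Set} (S? : Decidable S) (noV : ¬ VShape S)
  {i j} (c∈ : S (i , j))
  (rowMax : ∀ {j′} → S (i , j′) → j′ ≤ᶠ j) (colMax : ∀ {i′} → S (i′ , j) → i′ ≤ᶠ i) where

  private
    UpperRight : Fin (suc l) → Set
    UpperRight j′ = j <ᶠ j′ × ∃ λ i′ → i <ᶠ i′ × S (i′ , j′)

    UpperRight? : Decidable UpperRight
    UpperRight? j′ = (j Fin.<? j′) ×-dec Fin.any? (λ i′ → (i Fin.<? i′) ×-dec S? (i′ , j′))

    rightOf-∉ : ∀ {m} → j <ᶠ m → ¬ S (i , m)
    rightOf-∉ j<m x∈ = ℕ.<⇒≱ j<m (rowMax x∈)

  rowColMax⇒extensible : j ≢ fromℕ l → ∃ λ x → ¬ S x × ¬ VShape (S ∪₁ x)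
  rowColMax⇒extensible j≢last with Fin.any? UpperRight?
  ... | yes upperRight with m , (j<m , i″ , i<i″ , b∈) , minimal ← least UpperRight? upperRight =
    (i , m) , rightOf-∉ j<m ,
    cornerShift-VFree noV c∈ rowMax colMax j<m
      (λ z∈ i<i′ j<j′ → minimal (j<j′ , _ , i<i′ , z∈)) (λ _ _ → i″ , i<i″ , b∈)
  ... | no noUpperRight = (i , fromℕ l) , rightOf-∉ j<last ,
    cornerShift-VFree noV c∈ rowMax colMax j<last
      (λ z∈ i<i′ j<j′ → ⊥-elim (noUpperRight (_ , j<j′ , _ , i<i′ , z∈)))
      (λ {_} {j′} _ last<j′ → ⊥-elim (ℕ.<⇒≱ last<j′ (Fin.≤fromℕ j′)))
    where
    j<last : j <ᶠ fromℕ l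
    j<last = Fin.≤∧≢⇒< (Fin.≤fromℕ j) j≢last

∨₂-saturated⇒+≤∣∣G : ∀ {k l} (F : GSub (suc k) (suc l)) → StrongSaturated (∨₂ ∷ []) F →
  suc k + l ≤ ∣ F ∣G
∨₂-saturated⇒+≤∣∣G {k} {l} F sat@(free , saturated) =
  disjointInjections⇒+≤∣∣G F rowMaximum colMaximum (cong proj₁) (Fin.inject₁-injective ∘ cong proj₂)
    distinct (proj₁ ∘ proj₂ ∘ lastInRow) (proj₁ ∘ proj₂ ∘ topOfCol ∘ inject₁)
  where
  noHarmless = saturated-∨₂⇒noHarmless sat
  lastInRow : ∀ i → ∃ λ j → (i , j) ∈G F × (∀ {j′} → (i , j′) ∈G F → j′ ≤ᶠ j)
  lastInRow i = greatest (λ j → (i , j) ∈G? F) (noHarmless⇒rowNonempty (_∈G? F) noHarmless zero i)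
  topOfCol : ∀ j → ∃ λ i → (i , j) ∈G F × (∀ {i′} → (i′ , j) ∈G F → i′ ≤ᶠ i)
  topOfCol j = greatest (λ i → (i , j) ∈G? F) (noHarmless⇒colNonempty (_∈G? F) noHarmless zero j)
  rowMaximum : Fin (suc k) → Grid (suc k) (suc l)
  rowMaximum i = i , proj₁ (lastInRow i)
  colMaximum : Fin l → Grid (suc k) (suc l)
  colMaximum j = proj₁ (topOfCol (inject₁ j)) , inject₁ j
  distinct : ∀ i j → rowMaximum i ≢ colMaximum j
  distinct i j eq with lastInRow i | topOfCol (inject₁ j) | eq
  ... | _ , c∈ , rowMax | _ , _ , colMax | refl
    with x , x∉ , noV ←
      rowColMax⇒extensible (_∈G? F) (strongFree-∨₂⁻ free) c∈ rowMax colMax (Fin.fromℕ≢inject₁ ∘ sym)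
    = saturated x x∉ (strongFree-∨₂⁺ noV)

module _ {k l} (F : GSub k (suc l)) (noV : ¬ VShape (_∈G F)) where

  private
    HasRight : Grid k (suc l) → Set
    HasRight (i , j) = ∃ λ j′ → j <ᶠ j′ × (i , j′) ∈G F

    HasRight? : Decidable HasRight
    HasRight? (i , j) = Fin.any? λ j′ → (j Fin.<? j′) ×-dec ((i , j′) ∈G? F)

    -- Otherwise (i , j), its right neighbour and (i′ , j) would form a V.
    noneAbove : ∀ {i i′ j} → (i , j) ∈G F → (i′ , j) ∈G F → HasRight (i , j) → ¬ i <ᶠ i′
    noneAbove y∈ z∈ (_ , j<j′ , r∈) i<i′ =
      noV (fork _ _ _ y∈ r∈ z∈ (Fin.≤-refl , ℕ.<⇒≤ j<j′) (ℕ.<⇒≤ i<i′ , Fin.≤-refl)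
        (λ (_ , j′≤j) → ℕ.<⇒≱ j<j′ j′≤j) (λ (i′≤i , _) → ℕ.<⇒≱ i<i′ i′≤i))

    label : (y : Grid k (suc l)) → Dec (HasRight y) → ℕ
    label (_ , j) (yes _) = k + toℕ j
    label (i , _) (no _)  = toℕ i

    label-injective : ∀ {y z} → y ∈G F → z ∈G F → label y (HasRight? y) ≡ label z (HasRight? z) →
      y ≡ z
    label-injective {i , j} {i′ , j′} y∈ z∈ eq with HasRight? (i , j) | HasRight? (i′ , j′)
    ... | yes yRight | yes zRight
      with refl ← Fin.toℕ-injective (ℕ.+-cancelˡ-≡ k _ _ eq) with Fin.<-cmp i i′
    ...   | tri< i<i′ _ _ = ⊥-elim (noneAbove y∈ z∈ yRight i<i′)
    ...   | tri≈ _ i≡i′ _ = cong (_, j) i≡i′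
    ...   | tri> _ _ i′<i = ⊥-elim (noneAbove z∈ y∈ zRight i′<i)
    label-injective {i , j} {i′ , j′} y∈ z∈ eq | no yLast | no zLast
      with refl ← Fin.toℕ-injective eq with Fin.<-cmp j j′
    ...   | tri< j<j′ _ _ = ⊥-elim (yLast (j′ , j<j′ , z∈))
    ...   | tri≈ _ j≡j′ _ = cong (i ,_) j≡j′
    ...   | tri> _ _ j′<j = ⊥-elim (zLast (j , j′<j , y∈))
    label-injective {_ , _} {i′ , _} _ _ eq | yes _ | no _ =
      ⊥-elim (ℕ.<⇒≱ (Fin.toℕ<n i′) (subst (k ≤_) eq (ℕ.m≤m+n k _)))
    label-injective {i , _} _ _ eq | no _ | yes _ =
      ⊥-elim (ℕ.<⇒≱ (Fin.toℕ<n i) (subst (k ≤_) (sym eq) (ℕ.m≤m+n k _)))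

    label< : ∀ {y} → y ∈G F → label y (HasRight? y) < k + l
    label< {i , j} _ with HasRight? (i , j)
    ... | yes (j′ , j<j′ , _) = ℕ.+-monoʳ-< k (ℕ.<-≤-trans j<j′ (s≤s⁻¹ (Fin.toℕ<n j′)))
    ... | no _ = ℕ.<-≤-trans (Fin.toℕ<n i) (ℕ.m≤m+n k l)

  ∨₂-free⇒∣∣G≤+ : ∣ F ∣G ≤ k + l
  ∨₂-free⇒∣∣G≤+ = injectiveOn⇒∣∣G≤ F (λ y → label y (HasRight? y)) label-injective label<

-- The extremal constructions

m≤n∧n≡0⇒m≡0 : ∀ {m n} → m ≤ n → n ≡ 0 → m ≡ 0
m≤n∧n≡0⇒m≡0 m≤n refl = ℕ.n≤0⇒n≡0 m≤n

m+n≡o∧o≤n⇒m≡0 : ∀ {m n o} → m + n ≡ o → o ≤ n → m ≡ 0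
m+n≡o∧o≤n⇒m≡0 {m} {n} m+n≡o o≤n =
  ℕ.n≤0⇒n≡0 (ℕ.+-cancelʳ-≤ n m 0 (ℕ.≤-trans (ℕ.≤-reflexive m+n≡o) o≤n))

+-mono-≤-≡⇒≡ˡ : ∀ {m n m′ n′} → m ≤ m′ → n ≤ n′ → m + n ≡ m′ + n′ → m ≡ m′
+-mono-≤-≡⇒≡ˡ {m} {n} {m′} {n′} m≤m′ n≤n′ eq =
  ℕ.≤-antisym m≤m′
    (ℕ.+-cancelʳ-≤ n m′ m (ℕ.≤-trans (ℕ.+-monoʳ-≤ m′ n≤n′) (ℕ.≤-reflexive (sym eq))))

-- Hook and TailedDiagonal live on the (k + 1) × (l + 1) grid, with 0-based coordinates.
module Hook (k l : ℕ) where

  OnHook : Grid (suc k) (suc l) → Set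
  OnHook (i , j) = i ≡ zero ⊎ j ≡ fromℕ l

  OnHook? : Decidable OnHook
  OnHook? (i , j) = (i Fin.≟ zero) ⊎-dec (j Fin.≟ fromℕ l)

  hook : GSub (suc k) (suc l)
  hook = fromDec OnHook?

  hook-chain : ∀ {y z} → y ∈G hook → z ∈G hook → y ≤G z ⊎ z ≤G y
  hook-chain y∈ z∈ = comparable (∈-fromDec⁻ OnHook? y∈) (∈-fromDec⁻ OnHook? z∈)
    where
    comparable : ∀ {y z} → OnHook y → OnHook z → y ≤G z ⊎ z ≤G y
    comparable {_ , j} {_ , j′} (inj₁ refl) (inj₁ refl) =
      Sum.map (z≤n ,_) (z≤n ,_) (Fin.≤-total j j′)
    comparable {i , _} {i′ , _} (inj₂ refl) (inj₂ refl) =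
      Sum.map (_, Fin.≤-refl) (_, Fin.≤-refl) (Fin.≤-total i i′)
    comparable {_ , j} (inj₁ refl) (inj₂ refl) = inj₁ (z≤n , Fin.≤fromℕ j)
    comparable {_ , _} {_ , j′} (inj₂ refl) (inj₁ refl) = inj₂ (z≤n , Fin.≤fromℕ j′)

  hook-saturated : StrongSaturated (∨₂ ∷ []) hook
  hook-saturated =
    strongFree-∨₂⁺ (chain⇒noFork hook-chain) , λ x x∉ free → strongFree-∨₂⁻ free (forkThrough x x∉)
    where
    forkThrough : ∀ x → ¬ x ∈G hook → VShape ((_∈G hook) ∪₁ x)
    forkThrough (i , j) x∉ = fork (zero , j) (i , j) (zero , fromℕ l)
      (inj₁ (∈-fromDec⁺ OnHook? (inj₁ refl))) (inj₂ refl) (inj₁ (∈-fromDec⁺ OnHook? (inj₁ refl)))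
      (z≤n , Fin.≤-refl) (z≤n , Fin.≤fromℕ j)
      (λ (i≤0 , _) → x∉ (∈-fromDec⁺ OnHook? {i , j} (inj₁ (Fin.≤-antisym i≤0 z≤n))))
      (λ (_ , last≤j) →
        x∉ (∈-fromDec⁺ OnHook? {i , j} (inj₂ (Fin.≤-antisym (Fin.≤fromℕ j) last≤j))))

  ∣hook∣ : ∣ hook ∣G ≡ suc k + l
  ∣hook∣ = ℕ.≤-antisym
    (∨₂-free⇒∣∣G≤+ hook (chain⇒noFork hook-chain)) (∨₂-saturated⇒+≤∣∣G hook hook-saturated)

module TailedDiagonal (k l : ℕ) where

  δ : ℕ
  δ = k ⊓ l

  row col : Grid (suc k) (suc l) → ℕ
  row = toℕ ∘ proj₁
  col = toℕ ∘ proj₂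

  OnE : Grid (suc k) (suc l) → Set
  OnE y = row y + col y ≡ δ ⊎ (row y ≡ 0 × δ ≤ col y) ⊎ (col y ≡ 0 × δ ≤ row y)

  OnE? : Decidable OnE
  OnE? y = (row y + col y ℕ.≟ δ)
    ⊎-dec ((row y ℕ.≟ 0) ×-dec (δ ℕ.≤? col y)) ⊎-dec ((col y ℕ.≟ 0) ×-dec (δ ℕ.≤? row y))

  E : GSub (suc k) (suc l)
  E = fromDec OnE?

  point-≡ : ∀ {y z} → row y ≡ row z → col y ≡ col z → y ≡ z
  point-≡ r≡ c≡ = cong₂ _,_ (Fin.toℕ-injective r≡) (Fin.toℕ-injective c≡)

  SameAxis : Grid (suc k) (suc l) → Grid (suc k) (suc l) → Set
  SameAxis y z = (row y ≡ 0 × row z ≡ 0) ⊎ (col y ≡ 0 × col z ≡ 0)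

  sameAxis-sym : ∀ {y z} → SameAxis y z → SameAxis z y
  sameAxis-sym = Sum.map swap swap

  sameAxis-comparable : ∀ {y z} → SameAxis y z → y ≤G z ⊎ z ≤G y
  sameAxis-comparable {y} {z} (inj₁ (ry≡0 , rz≡0)) = Sum.map
    (ℕ.≤-reflexive (trans ry≡0 (sym rz≡0)) ,_) (ℕ.≤-reflexive (trans rz≡0 (sym ry≡0)) ,_)
    (ℕ.≤-total (col y) (col z))
  sameAxis-comparable {y} {z} (inj₂ (cy≡0 , cz≡0)) = Sum.map
    (_, ℕ.≤-reflexive (trans cy≡0 (sym cz≡0))) (_, ℕ.≤-reflexive (trans cz≡0 (sym cy≡0)))
    (ℕ.≤-total (row y) (row z))

  strictlyBelow⇒sameAxis : ∀ {y z} → OnE y → OnE z → y ≤G z → y ≢ z → SameAxis y z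
  strictlyBelow⇒sameAxis _ (inj₂ (inj₁ (rz≡0 , _))) (r≤ , _) _ =
    inj₁ (m≤n∧n≡0⇒m≡0 r≤ rz≡0 , rz≡0)
  strictlyBelow⇒sameAxis _ (inj₂ (inj₂ (cz≡0 , _))) (_ , c≤) _ =
    inj₂ (m≤n∧n≡0⇒m≡0 c≤ cz≡0 , cz≡0)
  strictlyBelow⇒sameAxis {y} {z} (inj₁ sy) (inj₁ sz) (r≤ , c≤) y≢z = ⊥-elim (y≢z (point-≡ r≡ c≡))
    where
    r≡ = +-mono-≤-≡⇒≡ˡ r≤ c≤ (trans sy (sym sz))
    c≡ = +-mono-≤-≡⇒≡ˡ c≤ r≤
      (trans (ℕ.+-comm (col y) (row y)) (trans sy (trans (sym sz) (ℕ.+-comm (row z) (col z)))))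
  strictlyBelow⇒sameAxis (inj₂ (inj₁ (ry≡0 , δ≤c))) (inj₁ sz) (_ , c≤) _ =
    inj₁ (ry≡0 , m+n≡o∧o≤n⇒m≡0 sz (ℕ.≤-trans δ≤c c≤))
  strictlyBelow⇒sameAxis {z = z} (inj₂ (inj₂ (cy≡0 , δ≤r))) (inj₁ sz) (r≤ , _) _ =
    inj₂ (cy≡0 , m+n≡o∧o≤n⇒m≡0 (trans (ℕ.+-comm (col z) (row z)) sz) (ℕ.≤-trans δ≤r r≤))

  sameAxis-through : ∀ {a b d} → ¬ (row a ≡ 0 × col a ≡ 0) → SameAxis a b → SameAxis a d →
    SameAxis b d
  sameAxis-through _ (inj₁ (_ , rb≡0)) (inj₁ (_ , rd≡0)) = inj₁ (rb≡0 , rd≡0)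
  sameAxis-through _ (inj₂ (_ , cb≡0)) (inj₂ (_ , cd≡0)) = inj₂ (cb≡0 , cd≡0)
  sameAxis-through notCorner (inj₁ (ra≡0 , _)) (inj₂ (ca≡0 , _)) = ⊥-elim (notCorner (ra≡0 , ca≡0))
  sameAxis-through notCorner (inj₂ (ca≡0 , _)) (inj₁ (ra≡0 , _)) = ⊥-elim (notCorner (ra≡0 , ca≡0))

  tinesOnAxis : ∀ {a b d} → OnE a → SameAxis a b → SameAxis a d → SameAxis b d
  tinesOnAxis {a} {b} {d} a∈ ab ad with δ ℕ.≟ 0
  ... | yes δ≡0 = thin⇒sameAxis b d
    where
    thin⇒sameAxis : ∀ y z → SameAxis y z
    thin⇒sameAxis (i , j) (i′ , j′) with ℕ.⊓-sel k l
    ... | inj₁ δ≡k =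
      inj₁ (m≤n∧n≡0⇒m≡0 (Fin.toℕ≤pred[n] i) k≡0 ,
            m≤n∧n≡0⇒m≡0 (Fin.toℕ≤pred[n] i′) k≡0)
      where k≡0 = trans (sym δ≡k) δ≡0
    ... | inj₂ δ≡l =
      inj₂ (m≤n∧n≡0⇒m≡0 (Fin.toℕ≤pred[n] j) l≡0 ,
            m≤n∧n≡0⇒m≡0 (Fin.toℕ≤pred[n] j′) l≡0)
      where l≡0 = trans (sym δ≡l) δ≡0
  ... | no δ≢0 = sameAxis-through (notCorner a∈) ab ad
    where
    notCorner : ∀ {y} → OnE y → ¬ (row y ≡ 0 × col y ≡ 0)
    notCorner (inj₁ r+c≡δ) (r≡0 , c≡0) = δ≢0 (trans (sym r+c≡δ) (cong₂ _+_ r≡0 c≡0))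
    notCorner (inj₂ (inj₁ (_ , δ≤c))) (_ , c≡0) = δ≢0 (m≤n∧n≡0⇒m≡0 δ≤c c≡0)
    notCorner (inj₂ (inj₂ (_ , δ≤r))) (r≡0 , _) = δ≢0 (m≤n∧n≡0⇒m≡0 δ≤r r≡0)

  E-forkFree : ¬ VShape (_∈G E) × ¬ ΛShape (_∈G E)
  E-forkFree = noV , noΛ
    where
    onE = ∈-fromDec⁻ OnE?
    noV : ¬ VShape (_∈G E)
    noV (fork _ _ _ a∈ b∈ d∈ a≤b a≤d b≰d d≰b) =
      Sum.[ b≰d , d≰b ] (sameAxis-comparable (tinesOnAxis (onE a∈)
        (strictlyBelow⇒sameAxis (onE a∈) (onE b∈) a≤b λ { refl → b≰d a≤d })
        (strictlyBelow⇒sameAxis (onE a∈) (onE d∈) a≤d λ { refl → d≰b a≤b })))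
    noΛ : ¬ ΛShape (_∈G E)
    noΛ (fork _ _ _ a∈ b∈ d∈ b≤a d≤a d≰b b≰d) =
      Sum.[ b≰d , d≰b ] (sameAxis-comparable (tinesOnAxis (onE a∈)
        (sameAxis-sym (strictlyBelow⇒sameAxis (onE b∈) (onE a∈) b≤a λ { refl → d≰b d≤a }))
        (sameAxis-sym (strictlyBelow⇒sameAxis (onE d∈) (onE a∈) d≤a λ { refl → b≰d b≤a }))))

  private
    δ∸m<1+l : ∀ m → δ ∸ m < suc l
    δ∸m<1+l m = s≤s (ℕ.≤-trans (ℕ.m∸n≤m δ m) (ℕ.m⊓n≤n k l))

    δ∸m<1+k : ∀ m → δ ∸ m < suc k
    δ∸m<1+k m = s≤s (ℕ.≤-trans (ℕ.m∸n≤m δ m) (ℕ.m⊓n≤m k l))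

  rowPartner : Fin (suc k) → Grid (suc k) (suc l)
  rowPartner i = i , fromℕ< (δ∸m<1+l (toℕ i))

  colPartner : Fin (suc l) → Grid (suc k) (suc l)
  colPartner j = fromℕ< (δ∸m<1+k (toℕ j)) , j

  col-rowPartner : ∀ i → col (rowPartner i) ≡ δ ∸ toℕ i
  col-rowPartner i = Fin.toℕ-fromℕ< (δ∸m<1+l (toℕ i))

  row-colPartner : ∀ j → row (colPartner j) ≡ δ ∸ toℕ j
  row-colPartner j = Fin.toℕ-fromℕ< (δ∸m<1+k (toℕ j))

  rowPartner∈ : ∀ i → rowPartner i ∈G E
  rowPartner∈ i = ∈-fromDec⁺ OnE? {rowPartner i} (onE (toℕ i ℕ.≤? δ))
    where
    onE : Dec (toℕ i ≤ δ) → OnE (rowPartner i)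
    onE (yes r≤δ) = inj₁ (trans (cong (toℕ i +_) (col-rowPartner i)) (ℕ.m+[n∸m]≡n r≤δ))
    onE (no r≰δ) = inj₂ (inj₂ (trans (col-rowPartner i) (ℕ.m≤n⇒m∸n≡0 δ≤r) , δ≤r))
      where δ≤r = ℕ.<⇒≤ (ℕ.≰⇒> r≰δ)

  colPartner∈ : ∀ j → colPartner j ∈G E
  colPartner∈ j = ∈-fromDec⁺ OnE? {colPartner j} (onE (toℕ j ℕ.≤? δ))
    where
    onE : Dec (toℕ j ≤ δ) → OnE (colPartner j)
    onE (yes c≤δ) = inj₁ (trans (cong (_+ toℕ j) (row-colPartner j)) (ℕ.m∸n+n≡m c≤δ))
    onE (no c≰δ) = inj₂ (inj₁ (trans (row-colPartner j) (ℕ.m≤n⇒m∸n≡0 δ≤c) , δ≤c))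
      where δ≤c = ℕ.<⇒≤ (ℕ.≰⇒> c≰δ)

  forkThrough : ∀ x → ¬ x ∈G E → VShape ((_∈G E) ∪₁ x) ⊎ ΛShape ((_∈G E) ∪₁ x)
  forkThrough (i , j) x∉ with ℕ.<-cmp (toℕ i + toℕ j) δ
  ... | tri≈ _ r+c≡δ _ = ⊥-elim (x∉ (∈-fromDec⁺ OnE? {i , j} (inj₁ r+c≡δ)))
  ... | tri< r+c<δ _ _ = inj₁ (fork (i , j) (rowPartner i) (colPartner j)
        (inj₂ refl) (inj₁ (rowPartner∈ i)) (inj₁ (colPartner∈ j))
        (Fin.≤-refl , subst (c ≤_) (sym (col-rowPartner i)) (ℕ.m+n≤o⇒m≤o∸n c (ℕ.<⇒≤ c+r<δ)))
        (subst (r ≤_) (sym (row-colPartner j)) (ℕ.m+n≤o⇒m≤o∸n r (ℕ.<⇒≤ r+c<δ)) , Fin.≤-refl)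
        (λ (_ , δ∸r≤c) →
          ℕ.<⇒≱ (ℕ.m+n≤o⇒m≤o∸n (suc c) c+r<δ) (subst (_≤ c) (col-rowPartner i) δ∸r≤c))
        (λ (δ∸c≤r , _) →
          ℕ.<⇒≱ (ℕ.m+n≤o⇒m≤o∸n (suc r) r+c<δ) (subst (_≤ r) (row-colPartner j) δ∸c≤r)))
    where
    r = toℕ i
    c = toℕ j
    c+r<δ : c + r < δ
    c+r<δ = subst (_< δ) (ℕ.+-comm r c) r+c<δ
  ... | tri> _ _ δ<r+c = inj₂ (fork (i , j) (rowPartner i) (colPartner j)
        (inj₂ refl) (inj₁ (rowPartner∈ i)) (inj₁ (colPartner∈ j))
        (Fin.≤-refl , subst (_≤ c) (sym (col-rowPartner i)) (ℕ.m≤n+o⇒m∸n≤o δ r (ℕ.<⇒≤ δ<r+c)))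
        (subst (_≤ r) (sym (row-colPartner j)) (ℕ.m≤n+o⇒m∸n≤o δ c (ℕ.<⇒≤ δ<c+r)) , Fin.≤-refl)
        (λ (_ , c≤δ∸r) → ℕ.<⇒≱ δ∸r<c (subst (c ≤_) (col-rowPartner i) c≤δ∸r))
        (λ (r≤δ∸c , _) → ℕ.<⇒≱ δ∸c<r (subst (r ≤_) (row-colPartner j) r≤δ∸c)))
    where
    r = toℕ i
    c = toℕ j
    δ<c+r : δ < c + r
    δ<c+r = subst (δ <_) (ℕ.+-comm r c) δ<r+c
    r≢0 : r ≢ 0
    r≢0 r≡0 =
      x∉ (∈-fromDec⁺ OnE? {i , j} (inj₂ (inj₁ (r≡0 , ℕ.<⇒≤ (subst (λ m → δ < m + c) r≡0 δ<r+c)))))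
    c≢0 : c ≢ 0
    c≢0 c≡0 =
      x∉ (∈-fromDec⁺ OnE? {i , j} (inj₂ (inj₂ (c≡0 , ℕ.<⇒≤ (subst (λ m → δ < m + r) c≡0 δ<c+r)))))
    δ∸r<c : δ ∸ r < c
    δ∸r<c = ℕ.m<n+o⇒m∸n<o δ r {{≢-nonZero c≢0}} δ<r+c
    δ∸c<r : δ ∸ c < r
    δ∸c<r = ℕ.m<n+o⇒m∸n<o δ c {{≢-nonZero r≢0}} δ<c+r

  E-saturated : StrongSaturated (∨₂ ∷ ∧₂ ∷ []) E
  E-saturated = strongFree-∨₂∧₂⁺ (proj₁ E-forkFree) (proj₂ E-forkFree) ,
    λ x x∉ free → let (noV , noΛ) = strongFree-∨₂∧₂⁻ free in Sum.[ noV , noΛ ] (forkThrough x x∉)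

  private
    onE = ∈-fromDec⁻ OnE?

    col≡δ∸row : ∀ y → y ∈G E → col y ≤ δ → col y ≡ δ ∸ row y
    col≡δ∸row y y∈ c≤δ with onE {y} y∈
    ... | inj₁ r+c≡δ = sym (trans (cong (_∸ row y) (sym r+c≡δ)) (ℕ.m+n∸m≡n (row y) (col y)))
    ... | inj₂ (inj₁ (r≡0 , δ≤c)) = trans (ℕ.≤-antisym c≤δ δ≤c) (cong (δ ∸_) (sym r≡0))
    ... | inj₂ (inj₂ (c≡0 , δ≤r)) = trans c≡0 (sym (ℕ.m≤n⇒m∸n≡0 δ≤r))

    row≡0 : ∀ y → y ∈G E → δ < col y → row y ≡ 0
    row≡0 y y∈ δ<c with onE {y} y∈
    ... | inj₁ r+c≡δ =
      ⊥-elim (ℕ.<⇒≱ δ<c (ℕ.≤-trans (ℕ.m≤n+m (col y) (row y)) (ℕ.≤-reflexive r+c≡δ)))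
    ... | inj₂ (inj₁ (r≡0 , _)) = r≡0
    ... | inj₂ (inj₂ (c≡0 , _)) = ⊥-elim (ℕ.<⇒≱ δ<c (ℕ.≤-trans (ℕ.≤-reflexive c≡0) z≤n))

    bothBounds : (i : Fin (suc k)) (j : Fin (suc l)) → toℕ i ≡ toℕ j → toℕ i ≤ δ
    bothBounds i j i≡j = ℕ.⊓-glb (Fin.toℕ≤pred[n] i) (subst (_≤ l) (sym i≡j) (Fin.toℕ≤pred[n] j))

    label : (y : Grid (suc k) (suc l)) → Dec (col y ≤ δ) → ℕ
    label y (yes _) = row y
    label y (no _)  = col y

    label-injective : ∀ {y z} → y ∈G E → z ∈G E →
      label y (col y ℕ.≤? δ) ≡ label z (col z ℕ.≤? δ) → y ≡ z
    label-injective {y} {z} y∈ z∈ eq with col y ℕ.≤? δ | col z ℕ.≤? δ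
    ... | yes cy≤δ | yes cz≤δ = point-≡ eq
      (trans (col≡δ∸row y y∈ cy≤δ) (trans (cong (δ ∸_) eq) (sym (col≡δ∸row z z∈ cz≤δ))))
    ... | no cy≰δ | no cz≰δ =
      point-≡ (trans (row≡0 y y∈ (ℕ.≰⇒> cy≰δ)) (sym (row≡0 z z∈ (ℕ.≰⇒> cz≰δ)))) eq
    ... | yes _ | no cz≰δ = ⊥-elim (cz≰δ (subst (_≤ δ) eq (bothBounds (proj₁ y) (proj₂ z) eq)))
    ... | no cy≰δ | yes _ =
      ⊥-elim (cy≰δ (subst (_≤ δ) (sym eq) (bothBounds (proj₁ z) (proj₂ y) (sym eq))))

    label< : ∀ {y} → y ∈G E → label y (col y ℕ.≤? δ) < suc k ⊔ suc l
    label< {i , j} _ with toℕ j ℕ.≤? δ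
    ... | yes _ = ℕ.<-≤-trans (Fin.toℕ<n i) (ℕ.m≤m⊔n (suc k) (suc l))
    ... | no _  = ℕ.<-≤-trans (Fin.toℕ<n j) (ℕ.m≤n⊔m (suc k) (suc l))

  ∣E∣ : ∣ E ∣G ≡ suc k ⊔ suc l
  ∣E∣ = ℕ.≤-antisym (injectiveOn⇒∣∣G≤ E (λ y → label y (col y ℕ.≤? δ)) label-injective label<)
    (noHarmless⇒⊔≤∣∣G E (saturated-∨₂∧₂⇒noHarmless E-saturated))

theorem1p9 : (∀ (k l : ℕ) → 1 ≤ k → 1 ≤ l → SatStarIs k l (∨₂ ∷ ∧₂ ∷ []) (k ⊔ l))
    × (∀ (k l : ℕ) → 1 ≤ k → 1 ≤ l →
        SatStarIs k l (∨₂ ∷ []) (k + l ∸ 1) × LaStarIs k l (∨₂ ∷ []) (k + l ∸ 1))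
theorem1p9 = part₁ , part₂
  where
  part₁ : ∀ (k l : ℕ) → 1 ≤ k → 1 ≤ l → SatStarIs k l (∨₂ ∷ ∧₂ ∷ []) (k ⊔ l)
  part₁ (suc k) (suc l) _ _ =
    (E , E-saturated , ∣E∣) ,
    λ F saturated → noHarmless⇒⊔≤∣∣G F (saturated-∨₂∧₂⇒noHarmless saturated)
    where open TailedDiagonal k l

  part₂ : ∀ (k l : ℕ) → 1 ≤ k → 1 ≤ l →
    SatStarIs k l (∨₂ ∷ []) (k + l ∸ 1) × LaStarIs k l (∨₂ ∷ []) (k + l ∸ 1)
  part₂ (suc k) (suc l) _ _ =
    subst (λ m → SatStarIs (suc k) (suc l) (∨₂ ∷ []) m × LaStarIs (suc k) (suc l) (∨₂ ∷ []) m)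
      (sym (ℕ.+-suc k l))
      ( ((hook , hook-saturated , ∣hook∣) , ∨₂-saturated⇒+≤∣∣G)
      , ((hook , proj₁ hook-saturated , ∣hook∣) , λ F free → ∨₂-free⇒∣∣G≤+ F (strongFree-∨₂⁻ free)))
    where open Hook k l
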